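{- Every imprimitive strongly regular graph is triply transitive.
   Context: A strongly regular graph $\Gamma$ is imprimitive if $\Gamma$ or its complement is disconnected (equivalently, $\Gamma$ is a disjoint union of at least two cliques of equal size, or a complete multipartite graph with parts of equal size). For $\Gamma=(\Omega,E)$: $A_0=I$, $A_1$ its adjacency matrix, $A_2=J-I-A_1$; for a vertex $\omega$, $E^*_{i,\omega}$ ($i=0,1,2$) is the diagonal matrix whose diagonal is the $\omega$-row of $A_i$; $T_\omega$ is the subalgebra of $M_{|\Omega|}(\mathbb C)$ generated by $A_0,A_1,A_2,E^*_{0,\omega},E^*_{1,\omega},E^*_{2,\omega}$; $T_{0,\omega}$ is the span of all $E^*_{i,\omega}A_jE^*_{k,\omega}$; $\tilde T_\omega$ is the algebra of complex matrices commuting with the permutation matrices of the stabilizer $G_\omega$ in $G=\mathrm{Aut}(\Gamma)$. $\Gamma$ is triply transitive if $G$ is transitive on $\Omega$ and $T_{0,\omega}=T_\omega=\tilde T_\omega$ for some (equivalently every) vertex $\omega$. -}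

module Defs where

open import Level using (Level; _⊔_)
open import Data.Nat using (ℕ; zero; suc) renaming (_+_ to _+ℕ_)
open import Data.Bool using (Bool; true; false; if_then_else_; _∧_; not)
open import Data.Fin using (Fin; _≟_)
import Data.Fin as F
open import Data.Fin.Permutation using (Permutation′; _⟨$⟩ʳ_)
open import Data.Product using (Σ; ∃; ∃-syntax; _×_; _,_)
open import Data.Sum using (_⊎_; inj₁; inj₂)
open import Relation.Nullary using (¬_; does)
open import Relation.Binary.PropositionalEquality using (_≡_)
open import Algebra.Bundles using (CommutativeRing)

record SimpleGraph (n : ℕ) : Set where
  field
    adj    : Fin n → Fin n → Bool
    adj-sym    : ∀ x y → adj x y ≡ adj y x
    adj-irrefl : ∀ x → adj x x ≡ false
open SimpleGraph public

count : ∀ {n} → (Fin n → Bool) → ℕ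
count {zero}  p = 0
count {suc n} p = (if p F.zero then 1 else 0) +ℕ count (λ i → p (F.suc i))

IsSRG : ∀ {n} → SimpleGraph n → ℕ → ℕ → ℕ → Set
IsSRG {n} Γ k l m =
  (∀ x → count (λ z → adj Γ x z) ≡ k) ×
  (∀ x y → adj Γ x y ≡ true → count (λ z → adj Γ x z ∧ adj Γ y z) ≡ l) ×
  (∀ x y → ¬ (x ≡ y) → adj Γ x y ≡ false → count (λ z → adj Γ x z ∧ adj Γ y z) ≡ m)

StronglyRegular : ∀ {n} → SimpleGraph n → Set
StronglyRegular Γ = ∃[ k ] ∃[ l ] ∃[ m ] IsSRG Γ k l m

complement : ∀ {n} → SimpleGraph n → SimpleGraph n
complement {n} Γ = record
  { adj = λ x y → not (does (x ≟ y)) ∧ not (adj Γ x y)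
  ; adj-sym = symm
  ; adj-irrefl = irr }
  where
  open import Relation.Binary.PropositionalEquality using (refl; sym)
  open import Relation.Nullary using (yes; no)
  open import Data.Empty using (⊥-elim)
  symm : ∀ x y → (not (does (x ≟ y)) ∧ not (adj Γ x y)) ≡ (not (does (y ≟ x)) ∧ not (adj Γ y x))
  symm x y with x ≟ y | y ≟ x
  ... | yes _ | yes _ = refl
  ... | no _  | no _  rewrite adj-sym Γ x y = refl
  ... | yes p | no q  = ⊥-elim (q (sym p))
  ... | no p  | yes q = ⊥-elim (p (sym q))
  irr : ∀ x → (not (does (x ≟ x)) ∧ not (adj Γ x x)) ≡ false
  irr x with x ≟ x
  ... | yes _ = refl
  ... | no p  = ⊥-elim (p refl)

data Reachable {n} (Γ : SimpleGraph n) : Fin n → Fin n → Set where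
  here : ∀ {x} → Reachable Γ x x
  step : ∀ {x y z} → adj Γ x y ≡ true → Reachable Γ y z → Reachable Γ x z

Disconnected : ∀ {n} → SimpleGraph n → Set
Disconnected Γ = ∃[ x ] ∃[ y ] ¬ Reachable Γ x y

Imprimitive : ∀ {n} → SimpleGraph n → Set
Imprimitive Γ = Disconnected Γ ⊎ Disconnected (complement Γ)

IsAut : ∀ {n} → SimpleGraph n → Permutation′ n → Set
IsAut Γ g = ∀ x y → adj Γ (g ⟨$⟩ʳ x) (g ⟨$⟩ʳ y) ≡ adj Γ x y

VertexTransitive : ∀ {n} → SimpleGraph n → Set
VertexTransitive Γ = ∀ x y → Σ _ λ g → IsAut Γ g × (g ⟨$⟩ʳ x ≡ y)

rel : ∀ {n} → SimpleGraph n → Fin 3 → Fin n → Fin n → Bool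
rel Γ F.zero x y                = does (x ≟ y)
rel Γ (F.suc F.zero) x y        = adj Γ x y
rel Γ (F.suc (F.suc F.zero)) x y = not (does (x ≟ y)) ∧ not (adj Γ x y)

module Over {c ℓ : Level} (R : CommutativeRing c ℓ) where
  open CommutativeRing R

  Mat : ℕ → Set c
  Mat n = Fin n → Fin n → Carrier

  _≈ₘ_ : ∀ {n} → Mat n → Mat n → Set ℓ
  M ≈ₘ N = ∀ i j → M i j ≈ N i j

  sumF : ∀ {n} → (Fin n → Carrier) → Carrier
  sumF {zero}  f = 0#
  sumF {suc n} f = f F.zero + sumF (λ i → f (F.suc i))

  _⊕_ : ∀ {n} → Mat n → Mat n → Mat n
  (M ⊕ N) i j = M i j + N i j

  _⊛_ : ∀ {n} → Mat n → Mat n → Mat n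
  (M ⊛ N) i j = sumF (λ k → M i k * N k j)

  _·_ : ∀ {n} → Carrier → Mat n → Mat n
  (a · M) i j = a * M i j

  0ₘ : ∀ {n} → Mat n
  0ₘ i j = 0#

  b2r : Bool → Carrier
  b2r b = if b then 1# else 0#

  Amat : ∀ {n} → SimpleGraph n → Fin 3 → Mat n
  Amat Γ i x y = b2r (rel Γ i x y)

  Estar : ∀ {n} → SimpleGraph n → Fin 3 → Fin n → Mat n
  Estar Γ i ω x y = b2r (does (x ≟ y) ∧ rel Γ i ω x)

  data InAlg {n} {I : Set} (gens : I → Mat n) : Mat n → Set (c ⊔ ℓ) where
    gen   : ∀ i → InAlg gens (gens i)
    zer   : InAlg gens 0ₘ
    add   : ∀ {M N} → InAlg gens M → InAlg gens N → InAlg gens (M ⊕ N)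
    scale : ∀ a {M} → InAlg gens M → InAlg gens (a · M)
    mul   : ∀ {M N} → InAlg gens M → InAlg gens N → InAlg gens (M ⊛ N)
    resp  : ∀ {M N} → M ≈ₘ N → InAlg gens M → InAlg gens N

  data InSpan {n} {I : Set} (gens : I → Mat n) : Mat n → Set (c ⊔ ℓ) where
    zer  : InSpan gens 0ₘ
    term : ∀ a i {M} → InSpan gens M → InSpan gens ((a · gens i) ⊕ M)
    resp : ∀ {M N} → M ≈ₘ N → InSpan gens M → InSpan gens N

  Tgens : ∀ {n} → SimpleGraph n → Fin n → (Fin 3 ⊎ Fin 3) → Mat n
  Tgens Γ ω (inj₁ i) = Amat Γ i
  Tgens Γ ω (inj₂ i) = Estar Γ i ω

  InT : ∀ {n} → SimpleGraph n → Fin n → Mat n → Set (c ⊔ ℓ)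
  InT Γ ω = InAlg (Tgens Γ ω)

  T0gens : ∀ {n} → SimpleGraph n → Fin n → (Fin 3 × Fin 3 × Fin 3) → Mat n
  T0gens Γ ω (i , j , k) = (Estar Γ i ω ⊛ Amat Γ j) ⊛ Estar Γ k ω

  InT0 : ∀ {n} → SimpleGraph n → Fin n → Mat n → Set (c ⊔ ℓ)
  InT0 Γ ω = InSpan (T0gens Γ ω)

  permMat : ∀ {n} → Permutation′ n → Mat n
  permMat g x y = b2r (does ((g ⟨$⟩ʳ x) ≟ y))

  InT~ : ∀ {n} → SimpleGraph n → Fin n → Mat n → Set ℓ
  InT~ Γ ω M = ∀ g → IsAut Γ g → g ⟨$⟩ʳ ω ≡ ω → (M ⊛ permMat g) ≈ₘ (permMat g ⊛ M)

  SameSet : ∀ {n a b} → (Mat n → Set a) → (Mat n → Set b) → Set (c ⊔ a ⊔ b)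
  SameSet P Q = ∀ M → (P M → Q M) × (Q M → P M)

  TriplyTransitive : ∀ {n} → SimpleGraph n → Set (c ⊔ ℓ)
  TriplyTransitive Γ = VertexTransitive' Γ ×
    ∃[ ω ] (SameSet (InT0 Γ ω) (InT Γ ω) × SameSet (InT Γ ω) (InT~ Γ ω))
    where
    VertexTransitive' = λ Γ → Level.Lift (c ⊔ ℓ) (VertexTransitive Γ)

{-# OPTIONS --safe #-}
module Submission where

-- An imprimitive strongly regular graph, or its complement, is a disjoint union of cliques of equal
-- size: two vertices in different components have no common neighbour, so μ = 0 and "equal or
-- adjacent" is an equivalence relation whose classes have k + 1 elements; and the complement of a
-- strongly regular graph is again regular with constant μ (namely n − 2k + λ). In a union of equal
-- cliques every vertex u can be moved to every vertex v by an automorphism fixing each vertex that is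
-- in the same relation to u as to v (a transposition inside a clique, or an exchange of two cliques).
-- Composing two such moves, the stabiliser of ω is transitive on the pairs (x, y) of each type
-- (rel ω x, rel x y, rel ω y). Hence the matrices of T_ω and the matrices commuting with the
-- stabiliser are both exactly the matrices constant on types, and these are spanned by the
-- E*_i A_j E*_k.

open import Defs
open import Level using (Level; lift)
open import Algebra.Bundles using (CommutativeRing)
open import Function using (_∘_; mk⇔)

open import Data.Nat using (ℕ; zero; suc) renaming (_+_ to _+ℕ_)
import Data.Nat.Properties as ℕₚ
open import Algebra.Properties.CommutativeSemigroup ℕₚ.+-commutativeSemigroup using (interchange)
open import Data.Bool using (Bool; true; false; if_then_else_; _∧_; _∨_; not)
open import Data.Bool.Properties
  using (not-involutive; ¬-not; not-¬; ⇔→≡; ∧-conicalˡ; ∧-conicalʳ; ∨-∧-booleanAlgebra)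
  renaming (_≟_ to _≟ᵇ_)
open import Algebra.Lattice.Properties.BooleanAlgebra ∨-∧-booleanAlgebra using (deMorgan₂)
open import Data.Fin using (Fin; zero; suc; _≟_; #_)
open import Data.Fin.Properties using (any?)
open import Data.Fin.Permutation as Perm using (Permutation′; _⟨$⟩ʳ_; _⟨$⟩ˡ_; _∘ₚ_)
import Data.Fin.Permutation.Components as PC
open import Data.Product using (Σ; _×_; _,_; proj₁; proj₂)
open import Data.Product.Properties using (≡-dec)
open import Data.Sum using (_⊎_; inj₁; inj₂; [_,_]′)
open import Data.Empty using (⊥-elim)
open import Relation.Nullary using (Dec; does; yes; no)
open import Relation.Nullary.Decidable using (dec-true; dec-false)
open import Relation.Binary.PropositionalEquality
  using (_≡_; _≢_; refl; sym; trans; cong; cong₂; subst; module ≡-Reasoning)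
open import Data.List using (List; []; _∷_; length; filter; tabulate; allFin)
open import Data.List.Membership.Propositional using (_∈_; _∉_)
open import Data.List.Membership.Propositional.Properties using (∈-filter⁺; ∈-filter⁻; ∈-allFin)
open import Data.List.Relation.Unary.Any using (here; there)
import Data.List.Relation.Unary.All as All
open import Data.List.Relation.Unary.AllPairs using ([]; _∷_)
open import Data.List.Relation.Unary.Unique.Propositional using (Unique)
open import Data.List.Relation.Unary.Unique.Propositional.Properties using (allFin⁺; filter⁺)
open import Data.List.Relation.Binary.Disjoint.Propositional using (Disjoint)

private
  variable
    n : ℕ

indicator : Bool → ℕ
indicator b = if b then 1 else 0

indicator≡0 : ∀ {b} → indicator b ≡ 0 → b ≡ false
indicator≡0 {false} _ = refl

indicator-not : ∀ b → indicator b +ℕ indicator (not b) ≡ 1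
indicator-not true  = refl
indicator-not false = refl

indicator-∨-∧ : ∀ a b → indicator (a ∨ b) +ℕ indicator (a ∧ b) ≡ indicator a +ℕ indicator b
indicator-∨-∧ true  true  = refl
indicator-∨-∧ true  false = refl
indicator-∨-∧ false true  = refl
indicator-∨-∧ false false = refl

count-cong : {p q : Fin n → Bool} → (∀ i → p i ≡ q i) → count p ≡ count q
count-cong {zero}  p≗q = refl
count-cong {suc n} p≗q = cong₂ _+ℕ_ (cong indicator (p≗q zero)) (count-cong (p≗q ∘ suc))

count-none : {p : Fin n → Bool} → (∀ i → p i ≡ false) → count p ≡ 0
count-none {zero}  none = refl
count-none {suc n} none rewrite none zero = count-none (none ∘ suc)

count≡0⇒false : (p : Fin n → Bool) → count p ≡ 0 → ∀ i → p i ≡ false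
count≡0⇒false p c zero    = indicator≡0 (ℕₚ.m+n≡0⇒m≡0 _ c)
count≡0⇒false p c (suc i) = count≡0⇒false (p ∘ suc) (ℕₚ.m+n≡0⇒n≡0 (indicator (p zero)) c) i

count-not : (p : Fin n → Bool) → count p +ℕ count (not ∘ p) ≡ n
count-not {zero}  p = refl
count-not {suc n} p = trans (interchange (indicator (p zero)) _ _ _)
                            (cong₂ _+ℕ_ (indicator-not (p zero)) (count-not (p ∘ suc)))

count-∨-∧ : (p q : Fin n → Bool) →
            count (λ i → p i ∨ q i) +ℕ count (λ i → p i ∧ q i) ≡ count p +ℕ count q
count-∨-∧ {zero}  p q = refl
count-∨-∧ {suc n} p q = trans (interchange (indicator (p zero ∨ q zero)) _ _ _)
  (trans (cong₂ _+ℕ_ (indicator-∨-∧ (p zero) (q zero)) (count-∨-∧ (p ∘ suc) (q ∘ suc)))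
         (interchange (indicator (p zero)) _ _ _))

count-≟ : (x : Fin n) → count (λ z → does (x ≟ z)) ≡ 1
count-≟ {suc n} zero    = cong suc (count-none {n} (λ _ → refl))
count-≟ {suc n} (suc x) = count-≟ x

length-filter-tabulate : ∀ {m} (p : Fin m → Bool) (f : Fin n → Fin m) →
                         length (filter (λ z → p z ≟ᵇ true) (tabulate f)) ≡ count (p ∘ f)
length-filter-tabulate {zero}  p f = refl
length-filter-tabulate {suc n} p f with p (f zero)
... | true  = cong suc (length-filter-tabulate p (f ∘ suc))
... | false = length-filter-tabulate p (f ∘ suc)

does-≟-sym : (x y : Fin n) → does (x ≟ y) ≡ does (y ≟ x)
does-≟-sym x y with x ≟ y
... | yes refl = sym (dec-true (x ≟ x) refl)
... | no x≢y   = sym (dec-false (y ≟ x) (x≢y ∘ sym))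

does-≟⇒≡ : {x y : Fin n} → does (x ≟ y) ≡ true → x ≡ y
does-≟⇒≡ {x = x} {y} x≟y with x ≟ y | x≟y
... | yes x≡y | _ = x≡y

permute-injective : (g : Permutation′ n) {x y : Fin n} → g ⟨$⟩ʳ x ≡ g ⟨$⟩ʳ y → x ≡ y
permute-injective g gx≡gy = trans (sym (Perm.inverseˡ g)) (trans (cong (g ⟨$⟩ˡ_) gx≡gy) (Perm.inverseˡ g))

does-≟-permute : (g : Permutation′ n) (x y : Fin n) → does (g ⟨$⟩ʳ x ≟ g ⟨$⟩ʳ y) ≡ does (x ≟ y)
does-≟-permute g x y with x ≟ y
... | yes refl = dec-true (g ⟨$⟩ʳ x ≟ g ⟨$⟩ʳ x) refl
... | no x≢y   = dec-false (_ ≟ _) (x≢y ∘ permute-injective g)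

does-≟-permuteˡ : (g : Permutation′ n) (x y : Fin n) → does (g ⟨$⟩ʳ x ≟ y) ≡ does (x ≟ g ⟨$⟩ˡ y)
does-≟-permuteˡ g x y =
  trans (cong (λ z → does (g ⟨$⟩ʳ x ≟ z)) (sym (Perm.inverseʳ g))) (does-≟-permute g x (g ⟨$⟩ˡ y))

transpose-mapsˡ : (i j : Fin n) → Perm.transpose i j ⟨$⟩ʳ i ≡ j
transpose-mapsˡ i j rewrite dec-true (i ≟ i) refl = refl

transpose-mapsʳ : (i j : Fin n) → Perm.transpose i j ⟨$⟩ʳ j ≡ i
transpose-mapsʳ i j with j ≟ i
... | yes refl = refl
... | no j≢i rewrite dec-true (j ≟ j) refl = refl

transpose-fixes : {i j k : Fin n} → k ≢ i → k ≢ j → Perm.transpose i j ⟨$⟩ʳ k ≡ k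
transpose-fixes {i = i} {j} {k} k≢i k≢j rewrite dec-false (k ≟ i) k≢i | dec-false (k ≟ j) k≢j = refl

transpose-fixes-indistinct : {i j k : Fin n} → does (k ≟ i) ≡ does (k ≟ j) →
                             Perm.transpose i j ⟨$⟩ʳ k ≡ k
transpose-fixes-indistinct {i = i} {j} {k} same with i ≟ k
... | yes refl = trans (transpose-mapsˡ i j) (sym (does-≟⇒≡ (trans (sym same) (dec-true (i ≟ i) refl))))
... | no i≢k   = transpose-fixes (i≢k ∘ sym)
                   (λ k≡j → i≢k (sym (does-≟⇒≡ (trans same (dec-true (k ≟ j) k≡j)))))

record Exchanges (π : Permutation′ n) (xs ys : List (Fin n)) : Set where
  field
    maps-xs    : ∀ {z} → z ∈ xs → π ⟨$⟩ʳ z ∈ ys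
    maps-ys    : ∀ {z} → z ∈ ys → π ⟨$⟩ʳ z ∈ xs
    fixes-rest : ∀ {z} → z ∉ xs → z ∉ ys → π ⟨$⟩ʳ z ≡ z

exchange : (xs ys : List (Fin n)) → length xs ≡ length ys → Unique xs → Unique ys → Disjoint xs ys →
           Σ (Permutation′ n) λ π → Exchanges π xs ys
exchange [] [] _ _ _ _ =
  Perm.id , record { maps-xs = λ () ; maps-ys = λ () ; fixes-rest = λ _ _ → refl }
exchange (x ∷ xs) (y ∷ ys) |x∷xs|≡|y∷ys| (x≢xs ∷ xs!) (y≢ys ∷ ys!) disjoint =
  π′ ∘ₚ τ , record { maps-xs = maps-xs ; maps-ys = maps-ys ; fixes-rest = fixes-rest }
  where
  rest = exchange xs ys (ℕₚ.suc-injective |x∷xs|≡|y∷ys|) xs! ys!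
                  (λ (z∈xs , z∈ys) → disjoint (there z∈xs , there z∈ys))
  π′ = proj₁ rest
  open Exchanges (proj₂ rest) renaming (maps-xs to π′-xs; maps-ys to π′-ys; fixes-rest to π′-rest)
  τ = Perm.transpose x y
  x∉xs : x ∉ xs
  x∉xs x∈xs = All.lookup x≢xs x∈xs refl
  y∉ys : y ∉ ys
  y∉ys y∈ys = All.lookup y≢ys y∈ys refl
  x∉ys : x ∉ ys
  x∉ys x∈ys = disjoint (here refl , there x∈ys)
  y∉xs : y ∉ xs
  y∉xs y∈xs = disjoint (there y∈xs , here refl)
  τ-fixes : ∀ {z zs} → x ∉ zs → y ∉ zs → z ∈ zs → τ ⟨$⟩ʳ z ≡ z
  τ-fixes x∉zs y∉zs z∈zs = transpose-fixes (λ { refl → x∉zs z∈zs }) (λ { refl → y∉zs z∈zs })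
  maps-xs : ∀ {z} → z ∈ x ∷ xs → τ ⟨$⟩ʳ (π′ ⟨$⟩ʳ z) ∈ y ∷ ys
  maps-xs (here refl) rewrite π′-rest x∉xs x∉ys = here (transpose-mapsˡ x y)
  maps-xs (there z∈xs) rewrite τ-fixes x∉ys y∉ys (π′-xs z∈xs) = there (π′-xs z∈xs)
  maps-ys : ∀ {z} → z ∈ y ∷ ys → τ ⟨$⟩ʳ (π′ ⟨$⟩ʳ z) ∈ x ∷ xs
  maps-ys (here refl) rewrite π′-rest y∉xs y∉ys = here (transpose-mapsʳ x y)
  maps-ys (there z∈ys) rewrite τ-fixes x∉xs y∉xs (π′-ys z∈ys) = there (π′-ys z∈ys)
  fixes-rest : ∀ {z} → z ∉ x ∷ xs → z ∉ y ∷ ys → τ ⟨$⟩ʳ (π′ ⟨$⟩ʳ z) ≡ z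
  fixes-rest z∉x∷xs z∉y∷ys rewrite π′-rest (z∉x∷xs ∘ there) (z∉y∷ys ∘ there) =
    transpose-fixes (z∉x∷xs ∘ here) (z∉y∷ys ∘ here)

-- Opaque, so that an equation between values of relOf determines their arguments during
-- unification; the three lemmas of this block are its whole interface.
opaque
  relOf : SimpleGraph n → Fin n → Fin n → Fin 3
  relOf Γ x y = if does (x ≟ y) then # 0 else if adj Γ x y then # 1 else # 2

  rel-relOf : (Γ : SimpleGraph n) (i : Fin 3) (x y : Fin n) → rel Γ i x y ≡ does (i ≟ relOf Γ x y)
  rel-relOf Γ zero x y with x ≟ y | adj Γ x y
  ... | yes _ | _     = refl
  ... | no _  | true  = refl
  ... | no _  | false = refl
  rel-relOf Γ (suc zero) x y with x ≟ y | adj Γ x y in xy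
  ... | yes refl | _     = trans (sym xy) (adj-irrefl Γ x)
  ... | no _     | true  = refl
  ... | no _     | false = refl
  rel-relOf Γ (suc (suc zero)) x y with x ≟ y | adj Γ x y
  ... | yes _ | _     = refl
  ... | no _  | true  = refl
  ... | no _  | false = refl

  relOf-aut : (Γ : SimpleGraph n) {g : Permutation′ n} → IsAut Γ g →
              ∀ x y → relOf Γ (g ⟨$⟩ʳ x) (g ⟨$⟩ʳ y) ≡ relOf Γ x y
  relOf-aut Γ {g} aut x y rewrite does-≟-permute g x y | aut x y = refl

  relOf-complement : (Γ : SimpleGraph n) (x y : Fin n) →
                     relOf (complement Γ) x y ≡ PC.transpose (# 1) (# 2) (relOf Γ x y)
  relOf-complement Γ x y with x ≟ y | adj Γ x y
  ... | yes _ | _     = refl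
  ... | no _  | true  = refl
  ... | no _  | false = refl

rel-cong : (Γ : SimpleGraph n) (i : Fin 3) {a b a′ b′ : Fin n} →
           relOf Γ a b ≡ relOf Γ a′ b′ → rel Γ i a b ≡ rel Γ i a′ b′
rel-cong Γ i {a} {b} {a′} {b′} same =
  trans (rel-relOf Γ i a b) (trans (cong (does ∘ (i ≟_)) same) (sym (rel-relOf Γ i a′ b′)))

relOf-moved : (Γ : SimpleGraph n) {g : Permutation′ n} → IsAut Γ g →
              ∀ {a a′} → g ⟨$⟩ʳ a ≡ a′ → ∀ b → relOf Γ a′ (g ⟨$⟩ʳ b) ≡ relOf Γ a b
relOf-moved Γ {g} aut {a} refl b = relOf-aut Γ {g} aut a b

aut-∘ : (Γ : SimpleGraph n) {g h : Permutation′ n} → IsAut Γ g → IsAut Γ h → IsAut Γ (g ∘ₚ h)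
aut-∘ Γ {g} aut-g aut-h x y = trans (aut-h (g ⟨$⟩ʳ x) (g ⟨$⟩ʳ y)) (aut-g x y)

isAut-via : (Γ : SimpleGraph n) (F : Fin n → Fin n → Bool) →
            (∀ x y → adj Γ x y ≡ not (does (x ≟ y)) ∧ F x y) →
            {g : Permutation′ n} → (∀ x y → F (g ⟨$⟩ʳ x) (g ⟨$⟩ʳ y) ≡ F x y) → IsAut Γ g
isAut-via Γ F adj≡ {g} F-invariant x y =
  trans (adj≡ _ _) (trans (cong₂ (λ d f → not d ∧ f) (does-≟-permute g x y) (F-invariant x y))
                          (sym (adj≡ x y)))

reflAdj : SimpleGraph n → Fin n → Fin n → Bool
reflAdj Γ x y = does (x ≟ y) ∨ adj Γ x y

reflAdj-sym : (Γ : SimpleGraph n) (x y : Fin n) → reflAdj Γ x y ≡ reflAdj Γ y x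
reflAdj-sym Γ x y = cong₂ _∨_ (does-≟-sym x y) (adj-sym Γ x y)

reflAdj-cong : (Γ : SimpleGraph n) {a b a′ b′ : Fin n} →
               relOf Γ a b ≡ relOf Γ a′ b′ → reflAdj Γ a b ≡ reflAdj Γ a′ b′
reflAdj-cong Γ same = cong₂ _∨_ (rel-cong Γ (# 0) same) (rel-cong Γ (# 1) same)

adj-via-reflAdj : (Γ : SimpleGraph n) (x y : Fin n) → adj Γ x y ≡ not (does (x ≟ y)) ∧ reflAdj Γ x y
adj-via-reflAdj Γ x y with x ≟ y
... | yes refl = adj-irrefl Γ x
... | no _     = refl

adj-via-complement : (Γ : SimpleGraph n) (x y : Fin n) →
                     adj Γ x y ≡ not (does (x ≟ y)) ∧ not (adj (complement Γ) x y)
adj-via-complement Γ x y with x ≟ y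
... | yes refl = adj-irrefl Γ x
... | no _     = sym (not-involutive (adj Γ x y))

complement-adj : (Γ : SimpleGraph n) (x y : Fin n) → adj (complement Γ) x y ≡ not (reflAdj Γ x y)
complement-adj Γ x y = sym (deMorgan₂ (does (x ≟ y)) (adj Γ x y))

adj-sym-true : (Γ : SimpleGraph n) {x y : Fin n} → adj Γ x y ≡ true → adj Γ y x ≡ true
adj-sym-true Γ {x} {y} xy = trans (adj-sym Γ y x) xy

rel₂⇒apart : (Γ : SimpleGraph n) {x y : Fin n} → rel Γ (# 2) x y ≡ true → x ≢ y × adj Γ x y ≡ false
rel₂⇒apart Γ {x} {y} r with x ≟ y | adj Γ x y | r
... | no x≢y | false | _ = x≢y , refl

apart⇒rel₂ : (Γ : SimpleGraph n) {x y : Fin n} → x ≢ y → adj Γ x y ≡ false → rel Γ (# 2) x y ≡ true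
apart⇒rel₂ Γ {x} {y} x≢y xy rewrite dec-false (x ≟ y) x≢y | xy = refl

rel₂-complement : (Γ : SimpleGraph n) (x y : Fin n) → rel (complement Γ) (# 2) x y ≡ adj Γ x y
rel₂-complement Γ x y with x ≟ y
... | yes refl = sym (adj-irrefl Γ x)
... | no _     = not-involutive (adj Γ x y)

degree : SimpleGraph n → Fin n → ℕ
degree Γ x = count (adj Γ x)

common : SimpleGraph n → Fin n → Fin n → ℕ
common Γ x y = count (λ z → adj Γ x z ∧ adj Γ y z)

Regular : SimpleGraph n → Set
Regular Γ = ∀ x y → degree Γ x ≡ degree Γ y

ConstantMu : SimpleGraph n → Set
ConstantMu Γ = ∀ x y x′ y′ → rel Γ (# 2) x y ≡ true → rel Γ (# 2) x′ y′ ≡ true →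
               common Γ x y ≡ common Γ x′ y′

count-reflAdj : (Γ : SimpleGraph n) (x : Fin n) → count (reflAdj Γ x) ≡ suc (degree Γ x)
count-reflAdj Γ x = begin
  count (reflAdj Γ x)
    ≡⟨ ℕₚ.+-identityʳ (count (reflAdj Γ x)) ⟨
  count (reflAdj Γ x) +ℕ 0
    ≡⟨ cong (count (reflAdj Γ x) +ℕ_) (count-none no-loop) ⟨
  count (reflAdj Γ x) +ℕ count (λ z → does (x ≟ z) ∧ adj Γ x z)
    ≡⟨ count-∨-∧ (λ z → does (x ≟ z)) (adj Γ x) ⟩
  count (λ z → does (x ≟ z)) +ℕ degree Γ x
    ≡⟨ cong (_+ℕ degree Γ x) (count-≟ x) ⟩
  suc (degree Γ x) ∎
  where
  open ≡-Reasoning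
  no-loop : ∀ z → does (x ≟ z) ∧ adj Γ x z ≡ false
  no-loop z with x ≟ z
  ... | yes refl = adj-irrefl Γ x
  ... | no _     = refl

degree-complement : (Γ : SimpleGraph n) (x : Fin n) → degree (complement Γ) x +ℕ suc (degree Γ x) ≡ n
degree-complement Γ x = begin
  degree (complement Γ) x +ℕ suc (degree Γ x)
    ≡⟨ cong₂ _+ℕ_ (count-cong (complement-adj Γ x)) (sym (count-reflAdj Γ x)) ⟩
  count (not ∘ reflAdj Γ x) +ℕ count (reflAdj Γ x)
    ≡⟨ ℕₚ.+-comm (count (not ∘ reflAdj Γ x)) _ ⟩
  count (reflAdj Γ x) +ℕ count (not ∘ reflAdj Γ x)
    ≡⟨ count-not (reflAdj Γ x) ⟩
  _ ∎
  where open ≡-Reasoning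

common-complement : (Γ : SimpleGraph n) {x y : Fin n} → adj Γ x y ≡ true →
                    common (complement Γ) x y +ℕ (degree Γ x +ℕ degree Γ y) ≡ n +ℕ common Γ x y
common-complement {n} Γ {x} {y} xy = begin
  common (complement Γ) x y +ℕ (degree Γ x +ℕ degree Γ y)
    ≡⟨ cong₂ _+ℕ_ (count-cong common-non-neighbour) (sym (count-∨-∧ (adj Γ x) (adj Γ y))) ⟩
  count (not ∘ neighbour) +ℕ (count neighbour +ℕ common Γ x y)
    ≡⟨ ℕₚ.+-assoc (count (not ∘ neighbour)) _ _ ⟨
  count (not ∘ neighbour) +ℕ count neighbour +ℕ common Γ x y
    ≡⟨ cong (_+ℕ common Γ x y) (trans (ℕₚ.+-comm (count (not ∘ neighbour)) _) (count-not neighbour)) ⟩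
  n +ℕ common Γ x y ∎
  where
  open ≡-Reasoning
  neighbour : Fin n → Bool
  neighbour z = adj Γ x z ∨ adj Γ y z
  reflAdj-∨ : ∀ z → reflAdj Γ x z ∨ reflAdj Γ y z ≡ neighbour z
  reflAdj-∨ z with x ≟ z | y ≟ z
  ... | yes refl | _        rewrite adj-irrefl Γ x | adj-sym-true Γ xy = refl
  ... | no _     | yes refl rewrite xy = refl
  ... | no _     | no _     = refl
  common-non-neighbour : ∀ z → adj (complement Γ) x z ∧ adj (complement Γ) y z ≡ not (neighbour z)
  common-non-neighbour z = begin
    adj (complement Γ) x z ∧ adj (complement Γ) y z
      ≡⟨ cong₂ _∧_ (complement-adj Γ x z) (complement-adj Γ y z) ⟩
    not (reflAdj Γ x z) ∧ not (reflAdj Γ y z)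
      ≡⟨ deMorgan₂ (reflAdj Γ x z) (reflAdj Γ y z) ⟨
    not (reflAdj Γ x z ∨ reflAdj Γ y z)
      ≡⟨ cong not (reflAdj-∨ z) ⟩
    not (neighbour z) ∎

module _ {Γ : SimpleGraph n} {k l m : ℕ} (srg : IsSRG Γ k l m) where
  private
    degree≡k = proj₁ srg
    common≡l = proj₁ (proj₂ srg)
    common≡m = proj₂ (proj₂ srg)

  srg-regular : Regular Γ
  srg-regular x y = trans (degree≡k x) (sym (degree≡k y))

  srg-constantMu : ConstantMu Γ
  srg-constantMu x y x′ y′ r r′ = trans (common≡m x y x≢y xy) (sym (common≡m x′ y′ x′≢y′ x′y′))
    where
    x≢y = proj₁ (rel₂⇒apart Γ r)
    xy = proj₂ (rel₂⇒apart Γ r)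
    x′≢y′ = proj₁ (rel₂⇒apart Γ r′)
    x′y′ = proj₂ (rel₂⇒apart Γ r′)

  complement-regular : Regular (complement Γ)
  complement-regular x y = ℕₚ.+-cancelʳ-≡ (suc k) _ _ (begin
    degree (complement Γ) x +ℕ suc k             ≡⟨ cong (λ d → _ +ℕ suc d) (degree≡k x) ⟨
    degree (complement Γ) x +ℕ suc (degree Γ x)  ≡⟨ degree-complement Γ x ⟩
    n                                            ≡⟨ degree-complement Γ y ⟨
    degree (complement Γ) y +ℕ suc (degree Γ y)  ≡⟨ cong (λ d → _ +ℕ suc d) (degree≡k y) ⟩
    degree (complement Γ) y +ℕ suc k             ∎)
    where open ≡-Reasoning

  complement-constantMu : ConstantMu (complement Γ)
  complement-constantMu x y x′ y′ r r′ =
    ℕₚ.+-cancelʳ-≡ (k +ℕ k) _ _ (trans (counted xy) (sym (counted x′y′)))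
    where
    xy = trans (sym (rel₂-complement Γ x y)) r
    x′y′ = trans (sym (rel₂-complement Γ x′ y′)) r′
    counted : ∀ {a b} → adj Γ a b ≡ true → common (complement Γ) a b +ℕ (k +ℕ k) ≡ n +ℕ l
    counted {a} {b} ab = begin
      common (complement Γ) a b +ℕ (k +ℕ k)
        ≡⟨ cong₂ (λ d e → common (complement Γ) a b +ℕ (d +ℕ e)) (degree≡k a) (degree≡k b) ⟨
      common (complement Γ) a b +ℕ (degree Γ a +ℕ degree Γ b)
        ≡⟨ common-complement Γ ab ⟩
      n +ℕ common Γ a b
        ≡⟨ cong (n +ℕ_) (common≡l a b ab) ⟩
      n +ℕ l ∎
      where open ≡-Reasoning

-- Disjoint unions of equal cliques

record IsCliqueUnion (Γ : SimpleGraph n) : Set where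
  field
    regular   : Regular Γ
    adj-trans : ∀ {x y z} → x ≢ z → adj Γ x y ≡ true → adj Γ y z ≡ true → adj Γ x z ≡ true

-- The disconnected pair has μ = 0 common neighbours, so every path x – y – z with x ≢ z closes up.
disconnected⇒cliqueUnion : {Γ : SimpleGraph n} → Regular Γ → ConstantMu Γ → Disconnected Γ →
                           IsCliqueUnion Γ
disconnected⇒cliqueUnion {Γ = Γ} regular constantMu (x₀ , y₀ , x₀↛y₀) =
  record { regular = regular ; adj-trans = adj-trans }
  where
  x₀y₀-apart : rel Γ (# 2) x₀ y₀ ≡ true
  x₀y₀-apart = apart⇒rel₂ Γ (λ { refl → x₀↛y₀ here }) (¬-not (λ x₀y₀ → x₀↛y₀ (step x₀y₀ here)))
  x₀y₀-no-common : common Γ x₀ y₀ ≡ 0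
  x₀y₀-no-common = count-none {p = λ z → adj Γ x₀ z ∧ adj Γ y₀ z} λ z → ¬-not λ x₀zy₀ →
    x₀↛y₀ (step (∧-conicalˡ _ _ x₀zy₀) (step (adj-sym-true Γ (∧-conicalʳ _ _ x₀zy₀)) here))
  adj-trans : ∀ {x y z} → x ≢ z → adj Γ x y ≡ true → adj Γ y z ≡ true → adj Γ x z ≡ true
  adj-trans {x} {y} {z} x≢z xy yz = ¬-not λ xz →
    not-¬ (cong₂ _∧_ xy (adj-sym-true Γ yz))
          (count≡0⇒false _ (trans (constantMu x z x₀ y₀ (apart⇒rel₂ Γ x≢z xz) x₀y₀-apart) x₀y₀-no-common) y)

-- Moves and types

record Move (Γ : SimpleGraph n) (u v : Fin n) : Set where
  field
    perm  : Permutation′ n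
    isAut : IsAut Γ perm
    maps  : perm ⟨$⟩ʳ u ≡ v
    fixes : ∀ {s} → relOf Γ s u ≡ relOf Γ s v → perm ⟨$⟩ʳ s ≡ s

complement-move : {Γ : SimpleGraph n} {u v : Fin n} → Move (complement Γ) u v → Move Γ u v
complement-move {Γ = Γ} {u} {v} move = record
  { perm  = perm
  ; isAut = isAut-via Γ (λ x y → not (adj (complement Γ) x y)) (adj-via-complement Γ) {perm}
                      (λ x y → cong not (isAut x y))
  ; maps  = maps
  ; fixes = λ {s} same → fixes (begin
      relOf (complement Γ) s u                ≡⟨ relOf-complement Γ s u ⟩
      PC.transpose (# 1) (# 2) (relOf Γ s u)  ≡⟨ cong (PC.transpose (# 1) (# 2)) same ⟩
      PC.transpose (# 1) (# 2) (relOf Γ s v)  ≡⟨ relOf-complement Γ s v ⟨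
      relOf (complement Γ) s v                ∎)
  }
  where
  open Move move
  open ≡-Reasoning

type : SimpleGraph n → Fin n → Fin n → Fin n → Fin 3 × Fin 3 × Fin 3
type Γ ω x y = relOf Γ ω x , relOf Γ x y , relOf Γ ω y

module _ {Γ : SimpleGraph n} {ω x y ω′ x′ y′ : Fin n} (same : type Γ ω x y ≡ type Γ ω′ x′ y′) where
  same-ωx : relOf Γ ω x ≡ relOf Γ ω′ x′
  same-ωx = cong proj₁ same

  same-xy : relOf Γ x y ≡ relOf Γ x′ y′
  same-xy = cong (proj₁ ∘ proj₂) same

  same-ωy : relOf Γ ω y ≡ relOf Γ ω′ y′
  same-ωy = cong (proj₂ ∘ proj₂) same

type-moved : (Γ : SimpleGraph n) {g : Permutation′ n} → IsAut Γ g → ∀ {ω x y ω′ x′ y′} →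
             g ⟨$⟩ʳ ω ≡ ω′ → g ⟨$⟩ʳ x ≡ x′ → g ⟨$⟩ʳ y ≡ y′ → type Γ ω′ x′ y′ ≡ type Γ ω x y
type-moved Γ {g} aut {ω} {x} {y} refl refl refl =
  cong₂ _,_ (relOf-aut Γ {g} aut ω x) (cong₂ _,_ (relOf-aut Γ {g} aut x y) (relOf-aut Γ {g} aut ω y))

TypeTransitive : SimpleGraph n → Set
TypeTransitive {n} Γ = ∀ {ω x y x′ y′} → type Γ ω x y ≡ type Γ ω x′ y′ →
  Σ (Permutation′ n) λ g → IsAut Γ g × g ⟨$⟩ʳ ω ≡ ω × g ⟨$⟩ʳ x ≡ x′ × g ⟨$⟩ʳ y ≡ y′

moves⇒vertexTransitive : {Γ : SimpleGraph n} → (∀ u v → Move Γ u v) → VertexTransitive Γ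
moves⇒vertexTransitive move u v = perm , isAut , maps
  where open Move (move u v)

moves⇒typeTransitive : {Γ : SimpleGraph n} → (∀ u v → Move Γ u v) → TypeTransitive Γ
moves⇒typeTransitive {Γ = Γ} move {ω} {x} {y} {x′} {y′} same =
  g₁ ∘ₚ g₂ , aut-∘ Γ {g₁} {g₂} aut₁ aut₂ ,
  trans (cong (g₂ ⟨$⟩ʳ_) g₁ω) g₂ω , trans (cong (g₂ ⟨$⟩ʳ_) g₁x) g₂x′ , g₂y
  where
  open Move (move x x′) renaming (perm to g₁; isAut to aut₁; maps to g₁x; fixes to fixes₁)
  open Move (move (g₁ ⟨$⟩ʳ y) y′) renaming (perm to g₂; isAut to aut₂; maps to g₂y; fixes to fixes₂)
  g₁ω : g₁ ⟨$⟩ʳ ω ≡ ω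
  g₁ω = fixes₁ (same-ωx same)
  g₂ω : g₂ ⟨$⟩ʳ ω ≡ ω
  g₂ω = fixes₂ (trans (relOf-moved Γ {g₁} aut₁ g₁ω y) (same-ωy same))
  g₂x′ : g₂ ⟨$⟩ʳ x′ ≡ x′
  g₂x′ = fixes₂ (trans (relOf-moved Γ {g₁} aut₁ g₁x y) (same-xy same))

module CliqueUnion {Γ : SimpleGraph n} (cliqueUnion : IsCliqueUnion Γ) where
  open IsCliqueUnion cliqueUnion

  infix 4 _∼_
  _∼_ : Fin n → Fin n → Set
  x ∼ y = reflAdj Γ x y ≡ true

  ∼-refl : ∀ x → x ∼ x
  ∼-refl x rewrite dec-true (x ≟ x) refl = refl

  ∼-sym : ∀ {x y} → x ∼ y → y ∼ x
  ∼-sym {x} {y} x∼y = trans (reflAdj-sym Γ y x) x∼y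

  ∼⇒≡⊎adj : ∀ {x y} → x ∼ y → x ≡ y ⊎ adj Γ x y ≡ true
  ∼⇒≡⊎adj {x} {y} x∼y with x ≟ y
  ... | yes x≡y = inj₁ x≡y
  ... | no _    = inj₂ x∼y

  ∼-trans : ∀ {x y z} → x ∼ y → y ∼ z → x ∼ z
  ∼-trans {x} {y} {z} x∼y y∼z with ∼⇒≡⊎adj x∼y | ∼⇒≡⊎adj y∼z
  ... | inj₁ refl | _         = y∼z
  ... | inj₂ _    | inj₁ refl = x∼y
  ... | inj₂ xy   | inj₂ yz   with x ≟ z
  ...   | yes _  = refl
  ...   | no x≢z = adj-trans x≢z xy yz

  reflAdj-resp : ∀ {x x′ y y′} → x ∼ x′ → y ∼ y′ → reflAdj Γ x y ≡ reflAdj Γ x′ y′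
  reflAdj-resp x∼x′ y∼y′ = ⇔→≡ (mk⇔ (λ x∼y → ∼-trans (∼-trans (∼-sym x∼x′) x∼y) y∼y′)
                                    (λ x′∼y′ → ∼-trans (∼-trans x∼x′ x′∼y′) (∼-sym y∼y′)))

  Preserves∼ : Permutation′ n → Set
  Preserves∼ g = ∀ x y → reflAdj Γ (g ⟨$⟩ʳ x) (g ⟨$⟩ʳ y) ≡ reflAdj Γ x y

  preserves∼-∘ : ∀ {g h} → Preserves∼ g → Preserves∼ h → Preserves∼ (g ∘ₚ h)
  preserves∼-∘ {g} g-pres h-pres x y = trans (h-pres (g ⟨$⟩ʳ x) (g ⟨$⟩ʳ y)) (g-pres x y)

  preserves∼⇒isAut : ∀ {g} → Preserves∼ g → IsAut Γ g
  preserves∼⇒isAut {g} = isAut-via Γ (reflAdj Γ) (adj-via-reflAdj Γ) {g}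

  ∼-transpose : ∀ {u v} → u ∼ v → ∀ x → x ∼ Perm.transpose u v ⟨$⟩ʳ x
  ∼-transpose {u} {v} u∼v x with u ≟ x | v ≟ x
  ... | yes refl | _        = subst (u ∼_) (sym (transpose-mapsˡ u v)) u∼v
  ... | no _     | yes refl = subst (v ∼_) (sym (transpose-mapsʳ u v)) (∼-sym u∼v)
  ... | no u≢x   | no v≢x   =
    subst (x ∼_) (sym (transpose-fixes {i = u} {v} (u≢x ∘ sym) (v≢x ∘ sym))) (∼-refl x)

  transpose-preserves∼ : ∀ {u v} → u ∼ v → Preserves∼ (Perm.transpose u v)
  transpose-preserves∼ u∼v x y = sym (reflAdj-resp (∼-transpose u∼v x) (∼-transpose u∼v y))

  block : Fin n → List (Fin n)
  block u = filter (λ z → reflAdj Γ u z ≟ᵇ true) (allFin n)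

  ∈-block⁺ : ∀ {u z} → u ∼ z → z ∈ block u
  ∈-block⁺ {u} {z} u∼z = ∈-filter⁺ (λ z → reflAdj Γ u z ≟ᵇ true) (∈-allFin z) u∼z

  ∈-block⁻ : ∀ {u z} → z ∈ block u → u ∼ z
  ∈-block⁻ {u} z∈u = proj₂ (∈-filter⁻ (λ z → reflAdj Γ u z ≟ᵇ true) {xs = allFin n} z∈u)

  ∉-block : ∀ {u z} → reflAdj Γ u z ≡ false → z ∉ block u
  ∉-block u≁z z∈u = not-¬ (∈-block⁻ z∈u) u≁z

  block-unique : ∀ u → Unique (block u)
  block-unique u = filter⁺ (λ z → reflAdj Γ u z ≟ᵇ true) (allFin⁺ n)

  length-block : ∀ u → length (block u) ≡ suc (degree Γ u)
  length-block u = trans (length-filter-tabulate (reflAdj Γ u) (λ z → z)) (count-reflAdj Γ u)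

  module BlockExchange {u v : Fin n} (u≁v : reflAdj Γ u v ≡ false)
                       {π : Permutation′ n} (exchanges : Exchanges π (block u) (block v)) where
    open Exchanges exchanges

    data Location (z : Fin n) : Set where
      inU : u ∼ z → Location z
      inV : v ∼ z → Location z
      out : reflAdj Γ u z ≡ false → reflAdj Γ v z ≡ false → Location z

    locate : ∀ z → Location z
    locate z with reflAdj Γ u z in uz | reflAdj Γ v z in vz
    ... | true  | _     = inU uz
    ... | false | true  = inV vz
    ... | false | false = out uz vz

    π-U : ∀ {z} → u ∼ z → v ∼ π ⟨$⟩ʳ z
    π-U u∼z = ∈-block⁻ (maps-xs (∈-block⁺ u∼z))

    π-V : ∀ {z} → v ∼ z → u ∼ π ⟨$⟩ʳ z
    π-V v∼z = ∈-block⁻ (maps-ys (∈-block⁺ v∼z))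

    π-out : ∀ {z} → reflAdj Γ u z ≡ false → reflAdj Γ v z ≡ false → π ⟨$⟩ʳ z ≡ z
    π-out u≁z v≁z = fixes-rest (∉-block u≁z) (∉-block v≁z)

    reflAdj-blocks : ∀ {a b x y} → a ∼ x → b ∼ y → reflAdj Γ x y ≡ reflAdj Γ a b
    reflAdj-blocks a∼x b∼y = sym (reflAdj-resp a∼x b∼y)

    apartˡ : ∀ {a x y} → reflAdj Γ a y ≡ false → a ∼ x → reflAdj Γ x y ≡ false
    apartˡ a≁y a∼x = trans (reflAdj-blocks a∼x (∼-refl _)) a≁y

    apartʳ : ∀ {a x y} → reflAdj Γ a x ≡ false → a ∼ y → reflAdj Γ x y ≡ false
    apartʳ {x = x} a≁x a∼y = trans (reflAdj-sym Γ x _) (apartˡ a≁x a∼y)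

    u∼u≡v∼v : reflAdj Γ u u ≡ reflAdj Γ v v
    u∼u≡v∼v = trans (∼-refl u) (sym (∼-refl v))

    π-preserves∼ : Preserves∼ π
    π-preserves∼ x y with locate x | locate y
    ... | inU ux    | inU uy    =
      trans (reflAdj-blocks (π-U ux) (π-U uy)) (trans (sym u∼u≡v∼v) (sym (reflAdj-blocks ux uy)))
    ... | inU ux    | inV vy    =
      trans (reflAdj-blocks (π-U ux) (π-V vy)) (trans (reflAdj-sym Γ v u) (sym (reflAdj-blocks ux vy)))
    ... | inV vx    | inU uy    =
      trans (reflAdj-blocks (π-V vx) (π-U uy)) (trans (reflAdj-sym Γ u v) (sym (reflAdj-blocks vx uy)))
    ... | inV vx    | inV vy    =
      trans (reflAdj-blocks (π-V vx) (π-V vy)) (trans u∼u≡v∼v (sym (reflAdj-blocks vx vy)))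
    ... | inU ux    | out uy vy rewrite π-out uy vy = trans (apartˡ vy (π-U ux)) (sym (apartˡ uy ux))
    ... | inV vx    | out uy vy rewrite π-out uy vy = trans (apartˡ uy (π-V vx)) (sym (apartˡ vy vx))
    ... | out ux vx | inU uy    rewrite π-out ux vx = trans (apartʳ vx (π-U uy)) (sym (apartʳ ux uy))
    ... | out ux vx | inV vy    rewrite π-out ux vx = trans (apartʳ ux (π-V vy)) (sym (apartʳ vx vy))
    ... | out ux vx | out uy vy rewrite π-out ux vx | π-out uy vy = refl

  move-within : ∀ {u v} → u ∼ v → Move Γ u v
  move-within {u} {v} u∼v = record
    { perm  = Perm.transpose u v
    ; isAut = preserves∼⇒isAut {Perm.transpose u v} (transpose-preserves∼ u∼v)
    ; maps  = transpose-mapsˡ u v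
    ; fixes = λ same → transpose-fixes-indistinct (rel-cong Γ (# 0) same)
    }

  -- Exchange the cliques of u and v, then transpose inside the clique of v so that u lands on v.
  move-across : ∀ {u v} → reflAdj Γ u v ≡ false → Move Γ u v
  move-across {u} {v} u≁v = record
    { perm  = π ∘ₚ τ
    ; isAut = preserves∼⇒isAut {π ∘ₚ τ} (preserves∼-∘ {π} {τ} π-preserves∼ (transpose-preserves∼ πu∼v))
    ; maps  = transpose-mapsˡ (π ⟨$⟩ʳ u) v
    ; fixes = fixes
    }
    where
    blocks-disjoint : Disjoint (block u) (block v)
    blocks-disjoint (z∈u , z∈v) = not-¬ (∼-trans (∈-block⁻ z∈u) (∼-sym (∈-block⁻ z∈v))) u≁v
    equal-length : length (block u) ≡ length (block v)
    equal-length = trans (length-block u) (trans (cong suc (regular u v)) (sym (length-block v)))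
    exchanged = exchange (block u) (block v) equal-length (block-unique u) (block-unique v) blocks-disjoint
    π = proj₁ exchanged
    open BlockExchange u≁v (proj₂ exchanged)
    τ = Perm.transpose (π ⟨$⟩ʳ u) v
    πu∼v : π ⟨$⟩ʳ u ∼ v
    πu∼v = ∼-sym (π-U (∼-refl u))
    fixes : ∀ {s} → relOf Γ s u ≡ relOf Γ s v → τ ⟨$⟩ʳ (π ⟨$⟩ʳ s) ≡ s
    fixes {s} same = trans (cong (τ ⟨$⟩ʳ_) (π-out u≁s v≁s)) (transpose-fixes s≢πu s≢v)
      where
      s∼u≡s∼v : reflAdj Γ s u ≡ reflAdj Γ s v
      s∼u≡s∼v = reflAdj-cong Γ same
      u≁s : reflAdj Γ u s ≡ false
      u≁s = ¬-not λ u∼s → not-¬ (∼-trans u∼s (trans (sym s∼u≡s∼v) (∼-sym u∼s))) u≁v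
      v≁s : reflAdj Γ v s ≡ false
      v≁s = ¬-not λ v∼s → not-¬ (∼-trans (∼-sym (trans s∼u≡s∼v (∼-sym v∼s))) (∼-sym v∼s)) u≁v
      s≢πu : s ≢ π ⟨$⟩ʳ u
      s≢πu refl = not-¬ (∼-sym πu∼v) v≁s
      s≢v : s ≢ v
      s≢v refl = not-¬ (∼-refl s) v≁s

  moves : ∀ u v → Move Γ u v
  moves u v with reflAdj Γ u v in u∼?v
  ... | true  = move-within u∼?v
  ... | false = move-across u∼?v

imprimitiveSRG-moves : {Γ : SimpleGraph n} → StronglyRegular Γ → Imprimitive Γ → ∀ u v → Move Γ u v
imprimitiveSRG-moves {Γ = Γ} (_ , _ , _ , srg) (inj₁ disconnected) =
  CliqueUnion.moves (disconnected⇒cliqueUnion (srg-regular {Γ = Γ} srg) (srg-constantMu {Γ = Γ} srg)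
                                              disconnected)
imprimitiveSRG-moves {Γ = Γ} (_ , _ , _ , srg) (inj₂ complement-disconnected) u v =
  complement-move (CliqueUnion.moves (disconnected⇒cliqueUnion {Γ = complement Γ}
    (complement-regular {Γ = Γ} srg) (complement-constantMu {Γ = Γ} srg) complement-disconnected) u v)

-- The algebras T₀, T and T̃

module TypeAlgebra {c ℓ} (R : CommutativeRing c ℓ) where
  open Over R
  open CommutativeRing R
    using (Carrier; _≈_; _+_; _*_; 0#; setoid; +-cong; +-congʳ; +-assoc; *-cong; *-congˡ; *-congʳ;
           *-assoc; *-comm; *-identityˡ; +-identityˡ; +-identityʳ; zeroˡ;
           +-commutativeMonoid; *-commutativeSemigroup)
    renaming (refl to ≈-refl; sym to ≈-sym; trans to ≈-trans; reflexive to ≈-reflexive)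
  open import Algebra.Properties.CommutativeMonoid.Sum +-commutativeMonoid using (sum; sum-permute)
  open import Algebra.Properties.CommutativeSemigroup *-commutativeSemigroup
    using (x∙yz≈y∙xz; x∙yz≈y∙zx; xy∙z≈z∙yx)
  open import Relation.Binary.Reasoning.Setoid setoid

  private
    variable
      m : ℕ

    _≟ₜ_ : (s t : Fin 3 × Fin 3 × Fin 3) → Dec (s ≡ t)
    _≟ₜ_ = ≡-dec _≟_ (≡-dec _≟_ _≟_)

  δ : Fin m → Fin m → Carrier
  δ i j = b2r (does (i ≟ j))

  b2r-∧ : ∀ a b → b2r (a ∧ b) ≈ b2r a * b2r b
  b2r-∧ true  b = ≈-sym (*-identityˡ (b2r b))
  b2r-∧ false b = ≈-sym (zeroˡ (b2r b))

  sumF-cong : {f g : Fin m → Carrier} → (∀ i → f i ≈ g i) → sumF f ≈ sumF g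
  sumF-cong {zero}  f≈g = ≈-refl
  sumF-cong {suc m} f≈g = +-cong (f≈g zero) (sumF-cong (f≈g ∘ suc))

  sumF-zero : {f : Fin m → Carrier} → (∀ i → f i ≈ 0#) → sumF f ≈ 0#
  sumF-zero {zero}  f≈0 = ≈-refl
  sumF-zero {suc m} f≈0 = ≈-trans (+-cong (f≈0 zero) (sumF-zero (f≈0 ∘ suc))) (+-identityˡ 0#)

  sumF-δ : (x : Fin m) (f : Fin m → Carrier) → sumF (λ w → δ w x * f w) ≈ f x
  sumF-δ {suc m} zero    f =
    ≈-trans (+-cong (*-identityˡ (f zero)) (sumF-zero (λ i → zeroˡ (f (suc i))))) (+-identityʳ (f zero))
  sumF-δ {suc m} (suc x) f = ≈-trans (+-cong (zeroˡ (f zero)) (sumF-δ x (f ∘ suc))) (+-identityˡ (f (suc x)))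

  sumF-δ′ : (x : Fin m) (f : Fin m → Carrier) → sumF (λ w → δ x w * f w) ≈ f x
  sumF-δ′ x f =
    ≈-trans (sumF-cong (λ w → ≈-reflexive (cong (λ b → b2r b * f w) (does-≟-sym x w)))) (sumF-δ x f)

  sumF-δ³ : (f : Fin m → Fin m → Fin m → Carrier) (a b c : Fin m) →
            sumF (λ i → sumF (λ j → sumF (λ k → f i j k * (δ k c * (δ j b * δ i a))))) ≈ f a b c
  sumF-δ³ f a b c = begin
    sumF (λ i → sumF (λ j → sumF (λ k → f i j k * (δ k c * (δ j b * δ i a)))))
      ≈⟨ sumF-cong (λ i → sumF-cong (λ j → innermost i j)) ⟩
    sumF (λ i → sumF (λ j → δ j b * (δ i a * f i j c)))
      ≈⟨ sumF-cong (λ i → sumF-δ b (λ j → δ i a * f i j c)) ⟩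
    sumF (λ i → δ i a * f i b c)
      ≈⟨ sumF-δ a (λ i → f i b c) ⟩
    f a b c ∎
    where
    innermost : ∀ i j → sumF (λ k → f i j k * (δ k c * (δ j b * δ i a))) ≈ δ j b * (δ i a * f i j c)
    innermost i j = ≈-trans (sumF-cong (λ k → x∙yz≈y∙zx (f i j k) (δ k c) _))
                            (≈-trans (sumF-δ c (λ k → (δ j b * δ i a) * f i j k)) (*-assoc _ _ _))

  sumF≡sum : (f : Fin m → Carrier) → sumF f ≡ sum f
  sumF≡sum {zero}  f = refl
  sumF≡sum {suc m} f = cong (f zero +_) (sumF≡sum (f ∘ suc))

  sumF-permute : (f : Fin m → Carrier) (g : Permutation′ m) → sumF f ≈ sumF (f ∘ (g ⟨$⟩ʳ_))
  sumF-permute f g rewrite sumF≡sum f | sumF≡sum (f ∘ (g ⟨$⟩ʳ_)) = sum-permute f g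

  ⊛-permMat : (M : Mat m) (g : Permutation′ m) (x y : Fin m) → (M ⊛ permMat g) x y ≈ M x (g ⟨$⟩ˡ y)
  ⊛-permMat M g x y =
    ≈-trans (sumF-cong λ k → ≈-trans (*-comm (M x k) _)
                               (≈-reflexive (cong (λ b → b2r b * M x k) (does-≟-permuteˡ g k y))))
            (sumF-δ (g ⟨$⟩ˡ y) (M x))

  permMat-⊛ : (M : Mat m) (g : Permutation′ m) (x y : Fin m) → (permMat g ⊛ M) x y ≈ M (g ⟨$⟩ʳ x) y
  permMat-⊛ M g x y = sumF-δ′ (g ⟨$⟩ʳ x) (λ k → M k y)

  module _ {I : Set} {gens : I → Mat m} where
    span-⊕ : ∀ {M N} → InSpan gens M → InSpan gens N → InSpan gens (M ⊕ N)
    span-⊕ {N = N} zer               N∈ = resp (λ x y → ≈-sym (+-identityˡ (N x y))) N∈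
    span-⊕ {N = N} (term a i {M} M∈) N∈ =
      resp (λ x y → ≈-sym (+-assoc _ (M x y) (N x y))) (term a i (span-⊕ M∈ N∈))
    span-⊕ (resp M≈M′ M∈)            N∈ = resp (λ x y → +-congʳ (M≈M′ x y)) (span-⊕ M∈ N∈)

    span-sumF : ∀ {k} (f : Fin k → Mat m) → (∀ i → InSpan gens (f i)) →
                InSpan gens (λ x y → sumF (λ i → f i x y))
    span-sumF {zero}  f f∈ = zer
    span-sumF {suc k} f f∈ = span-⊕ (f∈ zero) (span-sumF (f ∘ suc) (f∈ ∘ suc))

    span-scaled : ∀ a i → InSpan gens (a · gens i)
    span-scaled a i = resp (λ x y → +-identityʳ _) (term a i zer)

  module _ {n} (Γ : SimpleGraph n) (ω : Fin n) where
    TypeConstant : Mat n → Set ℓ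
    TypeConstant M = ∀ {x y x′ y′} → type Γ ω x y ≡ type Γ ω x′ y′ → M x y ≈ M x′ y′

    Amat-typeConstant : ∀ j → TypeConstant (Amat Γ j)
    Amat-typeConstant j same = ≈-reflexive (cong b2r (rel-cong Γ j (same-xy same)))

    Estar-typeConstant : ∀ i → TypeConstant (Estar Γ i ω)
    Estar-typeConstant i same =
      ≈-reflexive (cong b2r (cong₂ _∧_ (rel-cong Γ (# 0) (same-xy same)) (rel-cong Γ i (same-ωx same))))

    ⊛-typeConstant : TypeTransitive Γ → ∀ {M N} → TypeConstant M → TypeConstant N → TypeConstant (M ⊛ N)
    ⊛-typeConstant transitive {M} {N} M-const N-const {x} {y} {x′} {y′} same with transitive same
    ... | g , aut , gω , gx , gy = begin
      sumF (λ z → M x z * N z y)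
        ≈⟨ sumF-cong (λ z → *-cong (M-const (sym (type-moved Γ {g} aut {y = z} gω gx refl)))
                                   (N-const (sym (type-moved Γ {g} aut {x = z} gω refl gy)))) ⟩
      sumF (λ z → M x′ (g ⟨$⟩ʳ z) * N (g ⟨$⟩ʳ z) y′)
        ≈⟨ sumF-permute (λ z → M x′ z * N z y′) g ⟨
      sumF (λ z → M x′ z * N z y′) ∎

    InT⇒typeConstant : TypeTransitive Γ → ∀ {M} → InT Γ ω M → TypeConstant M
    InT⇒typeConstant transitive (gen (inj₁ j))    = Amat-typeConstant j
    InT⇒typeConstant transitive (gen (inj₂ i))    = Estar-typeConstant i
    InT⇒typeConstant transitive zer _             = ≈-refl
    InT⇒typeConstant transitive (add M∈ N∈) same  =
      +-cong (InT⇒typeConstant transitive M∈ same) (InT⇒typeConstant transitive N∈ same)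
    InT⇒typeConstant transitive (scale a M∈) same = *-congˡ (InT⇒typeConstant transitive M∈ same)
    InT⇒typeConstant transitive (mul M∈ N∈)       =
      ⊛-typeConstant transitive (InT⇒typeConstant transitive M∈) (InT⇒typeConstant transitive N∈)
    InT⇒typeConstant transitive (resp M≈N M∈) same =
      ≈-trans (≈-sym (M≈N _ _)) (≈-trans (InT⇒typeConstant transitive M∈ same) (M≈N _ _))

    InT0⇒InT : ∀ {M} → InT0 Γ ω M → InT Γ ω M
    InT0⇒InT zer                     = zer
    InT0⇒InT (term a (i , j , k) M∈) =
      add (scale a (mul (mul (gen (inj₂ i)) (gen (inj₁ j))) (gen (inj₂ k)))) (InT0⇒InT M∈)
    InT0⇒InT (resp M≈N M∈)           = resp M≈N (InT0⇒InT M∈)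

    -- The factors come in the order in which sumF-δ³ sums them out.
    T0gens-value : ∀ i j k x y →
      T0gens Γ ω (i , j , k) x y ≈ δ k (relOf Γ ω y) * (δ j (relOf Γ x y) * δ i (relOf Γ ω x))
    T0gens-value i j k x y = begin
      sumF (λ z → (Estar Γ i ω ⊛ Amat Γ j) x z * Estar Γ k ω z y)
        ≈⟨ sumF-cong (λ z → *-cong (Estar-⊛ z) (b2r-∧ (does (z ≟ y)) (rel Γ k ω z))) ⟩
      sumF (λ z → (rᵢ * Amat Γ j x z) * (δ z y * b2r (rel Γ k ω z)))
        ≈⟨ sumF-cong (λ z → x∙yz≈y∙xz (rᵢ * Amat Γ j x z) (δ z y) _) ⟩
      sumF (λ z → δ z y * ((rᵢ * Amat Γ j x z) * b2r (rel Γ k ω z)))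
        ≈⟨ sumF-δ y (λ z → (rᵢ * Amat Γ j x z) * b2r (rel Γ k ω z)) ⟩
      (rᵢ * Amat Γ j x y) * b2r (rel Γ k ω y)
        ≈⟨ xy∙z≈z∙yx rᵢ (Amat Γ j x y) _ ⟩
      b2r (rel Γ k ω y) * (Amat Γ j x y * rᵢ)
        ≡⟨ cong₂ _*_ (cong b2r (rel-relOf Γ k ω y))
                     (cong₂ _*_ (cong b2r (rel-relOf Γ j x y)) (cong b2r (rel-relOf Γ i ω x))) ⟩
      δ k (relOf Γ ω y) * (δ j (relOf Γ x y) * δ i (relOf Γ ω x)) ∎
      where
      rᵢ = b2r (rel Γ i ω x)
      Estar-⊛ : ∀ z → (Estar Γ i ω ⊛ Amat Γ j) x z ≈ rᵢ * Amat Γ j x z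
      Estar-⊛ z =
        ≈-trans (sumF-cong (λ w → ≈-trans (*-congʳ (b2r-∧ (does (x ≟ w)) (rel Γ i ω x))) (*-assoc _ _ _)))
                (sumF-δ′ x (λ w → rᵢ * Amat Γ j w z))

    coefficient : Mat n → Fin 3 × Fin 3 × Fin 3 → Carrier
    coefficient M t with any? (λ x → any? (λ y → type Γ ω x y ≟ₜ t))
    ... | yes (x , y , _) = M x y
    ... | no _            = 0#

    coefficient-type : ∀ {M} → TypeConstant M → ∀ x y → coefficient M (type Γ ω x y) ≈ M x y
    coefficient-type M-const x y with any? (λ a → any? (λ b → type Γ ω a b ≟ₜ type Γ ω x y))
    ... | yes (a , b , same) = M-const same
    ... | no no-witness      = ⊥-elim (no-witness (x , y , refl))

    expansion : Mat n → Mat n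
    expansion M x y = sumF λ i → sumF λ j → sumF λ k → coefficient M (i , j , k) * T0gens Γ ω (i , j , k) x y

    expansion-InT0 : ∀ M → InT0 Γ ω (expansion M)
    expansion-InT0 M = span-sumF _ λ i → span-sumF _ λ j → span-sumF _ λ k →
                         span-scaled (coefficient M (i , j , k)) (i , j , k)

    expansion-≈ : ∀ {M} → TypeConstant M → expansion M ≈ₘ M
    expansion-≈ {M} M-const x y = begin
      expansion M x y
        ≈⟨ sumF-cong (λ i → sumF-cong (λ j → sumF-cong (λ k →
             *-congˡ {coefficient M (i , j , k)} (T0gens-value i j k x y)))) ⟩
      sumF (λ i → sumF (λ j → sumF (λ k →
        coefficient M (i , j , k) * (δ k (relOf Γ ω y) * (δ j (relOf Γ x y) * δ i (relOf Γ ω x))))))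
        ≈⟨ sumF-δ³ (λ i j k → coefficient M (i , j , k)) (relOf Γ ω x) (relOf Γ x y) (relOf Γ ω y) ⟩
      coefficient M (type Γ ω x y)
        ≈⟨ coefficient-type M-const x y ⟩
      M x y ∎

    typeConstant⇒InT0 : ∀ {M} → TypeConstant M → InT0 Γ ω M
    typeConstant⇒InT0 {M} M-const = resp (expansion-≈ M-const) (expansion-InT0 M)

    typeConstant⇒InT~ : ∀ {M} → TypeConstant M → InT~ Γ ω M
    typeConstant⇒InT~ {M} M-const g aut gω x y = begin
      (M ⊛ permMat g) x y  ≈⟨ ⊛-permMat M g x y ⟩
      M x (g ⟨$⟩ˡ y)        ≈⟨ M-const (type-moved Γ {g} aut gω refl (Perm.inverseʳ g)) ⟨
      M (g ⟨$⟩ʳ x) y        ≈⟨ permMat-⊛ M g x y ⟨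
      (permMat g ⊛ M) x y  ∎

    InT~⇒typeConstant : TypeTransitive Γ → ∀ {M} → InT~ Γ ω M → TypeConstant M
    InT~⇒typeConstant transitive {M} commutes {x} {y} same with transitive same
    ... | g , aut , gω , refl , refl = begin
      M x y                         ≡⟨ cong (M x) (Perm.inverseˡ g) ⟨
      M x (g ⟨$⟩ˡ (g ⟨$⟩ʳ y))       ≈⟨ ⊛-permMat M g x (g ⟨$⟩ʳ y) ⟨
      (M ⊛ permMat g) x (g ⟨$⟩ʳ y)  ≈⟨ commutes g aut gω x (g ⟨$⟩ʳ y) ⟩
      (permMat g ⊛ M) x (g ⟨$⟩ʳ y)  ≈⟨ permMat-⊛ M g x (g ⟨$⟩ʳ y) ⟩
      M (g ⟨$⟩ʳ x) (g ⟨$⟩ʳ y)       ∎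

    T0≡T : TypeTransitive Γ → SameSet (InT0 Γ ω) (InT Γ ω)
    T0≡T transitive M = InT0⇒InT , λ M∈T → typeConstant⇒InT0 (InT⇒typeConstant transitive M∈T)

    T≡T~ : TypeTransitive Γ → SameSet (InT Γ ω) (InT~ Γ ω)
    T≡T~ transitive M = (λ M∈T → typeConstant⇒InT~ (InT⇒typeConstant transitive M∈T))
                      , (λ M∈T~ → InT0⇒InT (typeConstant⇒InT0 (InT~⇒typeConstant transitive M∈T~)))

theorem5p3 : ∀ {c ℓ : Level} (R : CommutativeRing c ℓ) {n : _} (Γ : SimpleGraph n) →
    StronglyRegular Γ → Imprimitive Γ → Over.TriplyTransitive R Γ
theorem5p3 R Γ strongly-regular imprimitive =
  lift (moves⇒vertexTransitive moves) , ω , T0≡T Γ ω transitive , T≡T~ Γ ω transitive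
  where
  open TypeAlgebra R
  moves = imprimitiveSRG-moves strongly-regular imprimitive
  transitive = moves⇒typeTransitive moves
  ω = [ proj₁ , proj₁ ]′ imprimitive
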